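{- Let $n$ be an integer that is not a perfect square. Every Diophantine $m$-tuple with the property $D(n)$ that contains $1$ is a norm tuple, i.e. each of its elements is the norm of an integral ideal of $\mathbb{Q}(\sqrt{n})$.
   Context: For an integer $n$, a Diophantine $m$-tuple with the property $D(n)$ is a set $\{a_1,\ldots,a_m\}$ of $m$ distinct positive integers such that $a_ia_j+n$ is a perfect square for all $1\le i<j\le m$. A norm tuple is such a tuple of the form $\{\mathcal{N}(\mathfrak{a}_1),\ldots,\mathcal{N}(\mathfrak{a}_m)\}$ for integral ideals $\mathfrak{a}_i$ of $\mathbb{Q}(\sqrt{n})$, with $\mathcal{N}$ the absolute norm. -}

module Defs where

open import Data.Nat as ℕ using (ℕ; suc; zero)
open import Data.Integer as ℤ using (ℤ; +_; _+_; _*_; _-_; ∣_∣)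
open import Data.Integer.DivMod using (_/ℕ_; _%ℕ_)
open import Data.Product using (_×_; _,_; ∃; ∃-syntax; Σ-syntax)
open import Data.Fin using (Fin)
open import Relation.Binary.PropositionalEquality using (_≡_)
open import Relation.Nullary using (¬_)
open import Function.Definitions using (Injective)

IsSquare : ℤ → Set
IsSquare x = ∃[ k ] x ≡ k * k

-- Diophantine m-tuple with property D(n), given as an injective family
-- a : Fin m → ℕ of positive integers (distinct = injective).
IsDiophantineTuple : (n : ℤ) (m : ℕ) → (Fin m → ℕ) → Set
IsDiophantineTuple n m a =
  Injective _≡_ _≡_ a ×
  (∀ i → 0 ℕ.< a i) ×
  (∀ i j → ¬ i ≡ j → IsSquare ((+ a i) * (+ a j) + n))

-- squarefree integer (excludes 0 and ±k² for k ≥ 2 divisors)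
SquareFree : ℤ → Set
SquareFree d = ∀ (k : ℕ) → (k ℕ.* k) Data.Nat.Divisibility.∣ ∣ d ∣ → k ≡ 1
  where import Data.Nat.Divisibility

-- Ring of integers of Q(√d), d squarefree, d ≠ 1:  O_d = ℤ[ω] with
-- ω = (1+√d)/2 if d ≡ 1 (mod 4), ω = √d otherwise.
-- An element x + yω is represented by the pair (x , y).
-- ω² = p + q ω, with (p , q) given by omegaSq d.

O : Set
O = ℤ × ℤ

omegaSq : ℤ → ℤ × ℤ
omegaSq d with d %ℕ 4
... | suc zero = ((d - + 1) /ℕ 4 , + 1)
... | _        = (d , + 0)

mulO : ℤ → O → O → O
mulO d (a , b) (c , e) with omegaSq d
... | (p , q) = (a * c + b * e * p , a * e + b * c + b * e * q)

InSpan : O → O → O → Set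
InSpan (u₁ , u₂) (v₁ , v₂) (x₁ , x₂) =
  ∃[ i ] ∃[ j ] (x₁ ≡ i * u₁ + j * v₁ × x₂ ≡ i * u₂ + j * v₂)

-- A (nonzero) integral ideal of O_d, given by a ℤ-basis (u , v):
-- the ℤ-span of u, v is closed under multiplication by O_d.
IsIdealBasis : ℤ → O → O → Set
IsIdealBasis d u v = ∀ (r x : O) → InSpan u v x → InSpan u v (mulO d r x)

-- determinant of the basis; the absolute norm N(𝔞) = [O_d : 𝔞] = |det|
det : O → O → ℤ
det (u₁ , u₂) (v₁ , v₂) = u₁ * v₂ - u₂ * v₁

-- a is the absolute norm of a (nonzero) integral ideal of Q(√n):
-- Q(√n) = Q(√d) where n = f² d with d squarefree.
IsIdealNorm : ℤ → ℕ → Set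
IsIdealNorm n a =
  ∃[ d ] ∃[ f ] (SquareFree d × n ≡ f * f * d ×
    ∃[ u ] ∃[ v ] (IsIdealBasis d u v × ¬ det u v ≡ + 0 × a ≡ ∣ det u v ∣))

{-# OPTIONS --safe #-}
module Submission where

-- Write n = f² d with d squarefree, so that ℚ(√n) = ℚ(√d) has ring of integers
-- ℤ[ω]. For every α ∈ ℤ[ω] the lattice ℤα + ℤαω is the principal ideal (α), and
-- its index det(α, αω) is the norm N(α). If 1 belongs to a D(n)-tuple, every
-- other element a satisfies a + n = k², so a = k² − f² d = N(k + f√d); the
-- element 1 itself is N(1).

open import Defs
open import Data.Nat as ℕ using (ℕ; suc; zero; z≤n; s≤s; NonZero)
open import Data.Nat.Properties as ℕ using (anyUpTo?)
open import Data.Nat.Divisibility using (_∣_; _∣?_; divides; 0∣⇒≡0; ∣⇒≤)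
open import Data.Nat.Induction using (<-wellFounded)
open import Data.Integer using (ℤ; +_; -[1+_]; _+_; _*_; _-_; -_; ∣_∣)
open import Data.Integer.DivMod using (_/ℕ_; _%ℕ_; a≡a%ℕn+[a/ℕn]*n; n%ℕd<d)
open import Data.Integer.Properties using (+-identityˡ; *-comm; pos-*; neg-distribʳ-*; ∣-i∣≡∣i∣; +-injective)
open import Data.Integer.Tactic.RingSolver using (solve-∀)
open import Data.Fin using (Fin; _≟_)
open import Data.Product using (_×_; _,_; ∃-syntax)
open import Induction.WellFounded using (Acc; acc)
open import Relation.Nullary using (¬_; yes; no; contradiction)
open import Relation.Nullary.Decidable using (_×-dec_)
open import Relation.Binary.PropositionalEquality
  using (_≡_; _≢_; refl; sym; trans; cong; subst; module ≡-Reasoning)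
import Data.Nat.Tactic.RingSolver as ℕ-Solver

ω : O
ω = (+ 0 , + 1)

normForm : ℤ × ℤ → O → ℤ
normForm (p , q) (a , b) = a * a + q * a * b - p * b * b

-- r (iα + jαω) = (r (i + jω)) α, with r (i + jω) expanded using ω² = p + qω.
principal-isIdealBasis : ∀ d α → IsIdealBasis d α (mulO d α ω)
principal-isIdealBasis d (a₁ , a₂) (r₁ , r₂) (._ , ._) (i , j , refl , refl) with omegaSq d
... | (p , q) = r₁ * i + r₂ * j * p , r₁ * j + r₂ * i + r₂ * j * q
              , closed₁ a₁ a₂ r₁ r₂ i j p q , closed₂ a₁ a₂ r₁ r₂ i j p q
  where
  closed₁ : ∀ a₁ a₂ r₁ r₂ i j p q →
    let αω₁ = a₁ * + 0 + a₂ * + 1 * p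
        αω₂ = a₁ * + 1 + a₂ * + 0 + a₂ * + 1 * q
    in r₁ * (i * a₁ + j * αω₁) + r₂ * (i * a₂ + j * αω₂) * p
       ≡ (r₁ * i + r₂ * j * p) * a₁ + (r₁ * j + r₂ * i + r₂ * j * q) * αω₁
  closed₁ = solve-∀
  closed₂ : ∀ a₁ a₂ r₁ r₂ i j p q →
    let αω₁ = a₁ * + 0 + a₂ * + 1 * p
        αω₂ = a₁ * + 1 + a₂ * + 0 + a₂ * + 1 * q
    in r₁ * (i * a₂ + j * αω₂) + r₂ * (i * a₁ + j * αω₁) + r₂ * (i * a₂ + j * αω₂) * q
       ≡ (r₁ * i + r₂ * j * p) * a₂ + (r₁ * j + r₂ * i + r₂ * j * q) * αω₂
  closed₂ = solve-∀

det[α,αω]≡normForm : ∀ d α → det α (mulO d α ω) ≡ normForm (omegaSq d) α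
det[α,αω]≡normForm d (a₁ , a₂) with omegaSq d
... | (p , q) = identity a₁ a₂ p q
  where
  identity : ∀ a₁ a₂ p q →
    a₁ * (a₁ * + 1 + a₂ * + 0 + a₂ * + 1 * q) - a₂ * (a₁ * + 0 + a₂ * + 1 * p)
    ≡ a₁ * a₁ + q * a₁ * a₂ - p * a₂ * a₂
  identity = solve-∀

+r≡t*+m⇒r≡0 : ∀ {r m} t → r ℕ.< m → + r ≡ t * + m → r ≡ 0
+r≡t*+m⇒r≡0 (+ zero)    _   r≡0     = +-injective r≡0
+r≡t*+m⇒r≡0 {m = m} (+ suc k) r<m r≡tm =
  contradiction (subst (ℕ._< m) (+-injective (trans r≡tm (sym (pos-* (suc k) m)))) r<m)
                (ℕ.m+n≮m m (k ℕ.* m))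
+r≡t*+m⇒r≡0 {m = suc _} -[1+ k ] _ ()

x≡t*+m⇒x≡[x/ℕm]*+m : ∀ x t m .{{_ : NonZero m}} → x ≡ t * + m → x ≡ (x /ℕ m) * + m
x≡t*+m⇒x≡[x/ℕm]*+m x t m x≡tm = begin
  x                            ≡⟨ a≡a%ℕn+[a/ℕn]*n x m ⟩
  + (x %ℕ m) + q * + m         ≡⟨ cong (λ r → + r + q * + m) x%m≡0 ⟩
  + 0 + q * + m                ≡⟨ +-identityˡ (q * + m) ⟩
  q * + m                      ∎
  where
  open ≡-Reasoning
  q = x /ℕ m
  shift : ∀ r s → r ≡ (r + s) - s
  shift = solve-∀
  factor : ∀ t q m → t * m - q * m ≡ (t - q) * m
  factor = solve-∀
  remainder≡multiple : + (x %ℕ m) ≡ (t - q) * + m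
  remainder≡multiple = begin
    + (x %ℕ m)                      ≡⟨ shift (+ (x %ℕ m)) (q * + m) ⟩
    (+ (x %ℕ m) + q * + m) - q * + m ≡⟨ cong (_- q * + m) (sym (a≡a%ℕn+[a/ℕn]*n x m)) ⟩
    x - q * + m                     ≡⟨ cong (_- q * + m) x≡tm ⟩
    t * + m - q * + m               ≡⟨ factor t q (+ m) ⟩
    (t - q) * + m                   ∎
  x%m≡0 : x %ℕ m ≡ 0
  x%m≡0 = +r≡t*+m⇒r≡0 (t - q) (n%ℕd<d x m) remainder≡multiple

data OmegaSqView (d : ℤ) : ℤ × ℤ → Set where
  ω=√d       : OmegaSqView d (d , + 0)
  ω=[1+√d]/2 : ∀ {P} → d ≡ + 1 + + 4 * P → OmegaSqView d (P , + 1)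

omegaSq-view : ∀ d → OmegaSqView d (omegaSq d)
omegaSq-view d with d %ℕ 4 in d%4≡r
... | zero        = ω=√d
... | suc zero    = ω=[1+√d]/2 d≡1+4P
  where
  open ≡-Reasoning
  q = d /ℕ 4
  P = (d - + 1) /ℕ 4
  cancel : ∀ q → (+ 1 + q) - + 1 ≡ q
  cancel = solve-∀
  uncancel : ∀ d → d ≡ + 1 + (d - + 1)
  uncancel = solve-∀
  d-1≡q*4 : d - + 1 ≡ q * + 4
  d-1≡q*4 = begin
    d - + 1                     ≡⟨ cong (_- + 1) (a≡a%ℕn+[a/ℕn]*n d 4) ⟩
    + (d %ℕ 4) + q * + 4 - + 1  ≡⟨ cong (λ r → + r + q * + 4 - + 1) d%4≡r ⟩
    + 1 + q * + 4 - + 1         ≡⟨ cancel (q * + 4) ⟩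
    q * + 4                     ∎
  d≡1+4P : d ≡ + 1 + + 4 * P
  d≡1+4P = begin
    d                   ≡⟨ uncancel d ⟩
    + 1 + (d - + 1)     ≡⟨ cong (λ z → + 1 + z) (x≡t*+m⇒x≡[x/ℕm]*+m (d - + 1) q 4 d-1≡q*4) ⟩
    + 1 + P * + 4       ≡⟨ cong (λ z → + 1 + z) (*-comm P (+ 4)) ⟩
    + 1 + + 4 * P       ∎
... | suc (suc _) = ω=√d

normForm-represents-x²-dy² : ∀ {d pq} → OmegaSqView d pq → ∀ x y → ∃[ α ] normForm pq α ≡ x * x - y * y * d
normForm-represents-x²-dy² ω=√d             x y = (x , y) , identity _ x y
  where
  identity : ∀ d x y → x * x + + 0 * x * y - d * y * y ≡ x * x - y * y * d
  identity = solve-∀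
-- x + y√d = (x − y) + 2yω, as √d = 2ω − 1.
normForm-represents-x²-dy² (ω=[1+√d]/2 {P} refl) x y = (x - y , + 2 * y) , identity P x y
  where
  identity : ∀ P x y → (x - y) * (x - y) + + 1 * (x - y) * (+ 2 * y) - P * (+ 2 * y) * (+ 2 * y)
                       ≡ x * x - y * y * (+ 1 + + 4 * P)
  identity = solve-∀

isIdealNorm-of-normForm : ∀ {n a} d f → SquareFree d → n ≡ f * f * d → 0 ℕ.< a →
  ∀ α → + a ≡ normForm (omegaSq d) α → IsIdealNorm n a
isIdealNorm-of-normForm {a = a} d f sf n≡f²d a>0 α a≡Nα =
  d , f , sf , n≡f²d , α , mulO d α ω , principal-isIdealBasis d α , det≢0 , cong ∣_∣ a≡det
  where
  a≡det : + a ≡ det α (mulO d α ω)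
  a≡det = trans a≡Nα (sym (det[α,αω]≡normForm d α))
  det≢0 : det α (mulO d α ω) ≢ + 0
  det≢0 det≡0 = ℕ.n>0⇒n≢0 a>0 (+-injective (trans a≡det det≡0))

squareFree-if-no-square-factor : ∀ {M} → 0 ℕ.< M →
  ¬ (∃[ k ] k ℕ.< suc M × 2 ℕ.≤ k × k ℕ.* k ∣ M) → SquareFree (+ M)
squareFree-if-no-square-factor M>0 none zero          0∣M  = contradiction (0∣⇒≡0 0∣M) (ℕ.n>0⇒n≢0 M>0)
squareFree-if-no-square-factor M>0 none (suc zero)    _    = refl
squareFree-if-no-square-factor M>0 none k@(suc (suc _)) k²∣M =
  contradiction (k , s≤s (ℕ.≤-trans (ℕ.m≤m*n k k) (∣⇒≤ k²∣M)) , s≤s (s≤s z≤n) , k²∣M) none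
  where instance _ = ℕ.>-nonZero M>0

squareFree-decomposition : ∀ M → 0 ℕ.< M → ∃[ D ] ∃[ F ] (SquareFree (+ D) × M ≡ F ℕ.* F ℕ.* D)
squareFree-decomposition M = go M (<-wellFounded M)
  where
  regroup : ∀ K F D → F ℕ.* F ℕ.* D ℕ.* (K ℕ.* K) ≡ K ℕ.* F ℕ.* (K ℕ.* F) ℕ.* D
  regroup = ℕ-Solver.solve-∀
  1<k*k : ∀ {k} → 2 ℕ.≤ k → 1 ℕ.< k ℕ.* k
  1<k*k k≥2 = ℕ.≤-trans k≥2 (ℕ.m≤m*n _ _ {{ℕ.>-nonZero (ℕ.≤-trans (s≤s z≤n) k≥2)}})
  go : ∀ M → Acc ℕ._<_ M → 0 ℕ.< M → ∃[ D ] ∃[ F ] (SquareFree (+ D) × M ≡ F ℕ.* F ℕ.* D)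
  go M (acc smaller) M>0 with anyUpTo? (λ k → (2 ℕ.≤? k) ×-dec (k ℕ.* k ∣? M)) (suc M)
  ... | no none = M , 1 , squareFree-if-no-square-factor M>0 none , sym (ℕ.+-identityʳ M)
  ... | yes (k , _ , k≥2 , divides zero M≡0) = contradiction M≡0 (ℕ.n>0⇒n≢0 M>0)
  ... | yes (k , _ , k≥2 , divides M'@(suc _) M≡M'k²)
    with go M' (smaller (subst (M' ℕ.<_) (sym M≡M'k²) (ℕ.m<m*n M' (k ℕ.* k) (1<k*k k≥2)))) (s≤s z≤n)
  ... | D , F , sf , M'≡F²D =
    D , k ℕ.* F , sf , trans M≡M'k² (trans (cong (ℕ._* (k ℕ.* k)) M'≡F²D) (regroup k F D))

pos-F*F*D : ∀ F D → + (F ℕ.* F ℕ.* D) ≡ + F * + F * + D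
pos-F*F*D F D = trans (pos-* (F ℕ.* F) D) (cong (_* + D) (pos-* F F))

squareFree-decompositionℤ : ∀ {n} → n ≢ + 0 → ∃[ d ] ∃[ f ] (SquareFree d × n ≡ f * f * d)
squareFree-decompositionℤ {+ zero} n≢0 = contradiction refl n≢0
squareFree-decompositionℤ {+ suc m} _ with squareFree-decomposition (suc m) (s≤s z≤n)
... | D , F , sf , m≡F²D = + D , + F , sf , trans (cong +_ m≡F²D) (pos-F*F*D F D)
squareFree-decompositionℤ { -[1+ m ]} _ with squareFree-decomposition (suc m) (s≤s z≤n)
... | D , F , sf , m≡F²D =
  - + D , + F , sf-neg , trans (cong (λ z → - + z) m≡F²D)
                               (trans (cong -_ (pos-F*F*D F D)) (neg-distribʳ-* (+ F * + F) (+ D)))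
  where
  sf-neg : SquareFree (- + D)
  sf-neg k k²∣D = sf k (subst (k ℕ.* k ∣_) (∣-i∣≡∣i∣ (+ D)) k²∣D)

x²-ny²-isIdealNorm : ∀ {n a} → n ≢ + 0 → 0 ℕ.< a → ∀ x y → + a ≡ x * x - y * y * n → IsIdealNorm n a
x²-ny²-isIdealNorm {n} {a} n≢0 a>0 x y a≡x²-ny² with squareFree-decompositionℤ n≢0
... | d , f , sf , n≡f²d with normForm-represents-x²-dy² (omegaSq-view d) x (y * f)
... | α , Nα≡x²-d[yf]² = isIdealNorm-of-normForm d f sf n≡f²d a>0 α (begin
  + a                          ≡⟨ a≡x²-ny² ⟩
  x * x - y * y * n            ≡⟨ cong (λ m → x * x - y * y * m) n≡f²d ⟩
  x * x - y * y * (f * f * d)  ≡⟨ regroup x y f d ⟩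
  x * x - y * f * (y * f) * d  ≡⟨ sym Nα≡x²-d[yf]² ⟩
  normForm (omegaSq d) α       ∎)
  where
  open ≡-Reasoning
  regroup : ∀ x y f d → x * x - y * y * (f * f * d) ≡ x * x - y * f * (y * f) * d
  regroup = solve-∀

tuple-with-1⇒x²-ny² : ∀ {n m} (a : Fin m → ℕ) {i₀} → (∀ i j → i ≢ j → IsSquare (+ a i * + a j + n)) →
  a i₀ ≡ 1 → ∀ j → ∃[ x ] ∃[ y ] + a j ≡ x * x - y * y * n
tuple-with-1⇒x²-ny² {n} _ {i₀} _ a[i₀]≡1 j with j ≟ i₀
... | yes refl = + 1 , + 0 , trans (cong +_ a[i₀]≡1) (one n)
  where
  one : ∀ n → + 1 ≡ + 1 * + 1 - + 0 * + 0 * n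
  one = solve-∀
tuple-with-1⇒x²-ny² {n} a {i₀} square a[i₀]≡1 j | no j≢i₀ with square j i₀ j≢i₀
... | k , aj·ai₀+n≡k² = k , + 1 , (begin
  + a j                                     ≡⟨ shift (+ a j) n ⟩
  + a j * + 1 + n - + 1 * + 1 * n           ≡⟨ cong (λ b → + a j * + b + n - + 1 * + 1 * n) (sym a[i₀]≡1) ⟩
  + a j * + a i₀ + n - + 1 * + 1 * n        ≡⟨ cong (_- + 1 * + 1 * n) aj·ai₀+n≡k² ⟩
  k * k - + 1 * + 1 * n                     ∎)
  where
  open ≡-Reasoning
  shift : ∀ a n → a ≡ a * + 1 + n - + 1 * + 1 * n
  shift = solve-∀

corollary3p3 : (n : ℤ) → ¬ IsSquare n → (m : ℕ) → (a : Fin m → ℕ) →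
    IsDiophantineTuple n m a → ∃[ i ] a i ≡ 1 → ∀ i → IsIdealNorm n (a i)
corollary3p3 n n-nonsquare _ a (_ , positive , square) (i₀ , a[i₀]≡1) j =
  let x , y , a[j]≡x²-ny² = tuple-with-1⇒x²-ny² a square a[i₀]≡1 j
  in x²-ny²-isIdealNorm n≢0 (positive j) x y a[j]≡x²-ny²
  where
  n≢0 : n ≢ + 0
  n≢0 refl = n-nonsquare (+ 0 , refl)
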